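{- Let $L$ be the graph defined below. Then $L$ is planar, admits a Hamiltonian path with endpoints $x$ and $y$, has no feedback vertex set of size three, has a feedback vertex set of size four whose removal disconnects $x$ and $y$, and has no feedback vertex set of size four containing $x$ or $y$.
   Context: A feedback vertex set of a graph $G$ is a vertex set $U$ such that $G-U$ is acyclic. $C_4*K_1$ denotes the wheel on five vertices (a 4-cycle plus a center adjacent to all four cycle vertices). The graph $L$ is obtained as follows: take two disjoint copies $W_1,W_2$ of $C_4*K_1$; let $\{v,w\}$ be an edge of the 4-cycle of $W_1$ and $\{v',w'\}$ an edge of the 4-cycle of $W_2$; add the edges $\{v,v'\}$ and $\{w,w'\}$. Let $\{x',x''\}$ be the remaining 4-cycle edge of $W_1$ both of whose endpoints still have degree three, and $\{y',y''\}$ the analogous edge of $W_2$. Add a vertex $x$ adjacent to exactly $x',x''$ and a vertex $y$ adjacent to exactly $y',y''$. -}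

module Defs where

open import Data.Bool using (Bool; true; false; _∨_; _∧_; not; T)
open import Data.Nat using (ℕ; zero; suc; _+_; _*_; _≤_) renaming (_≟_ to _ℕ≟_)
open import Data.Fin using (Fin; zero; suc; inject₁; fromℕ; toℕ; _≟_)
import Data.Fin
open import Data.Fin.Subset using (Subset; _∈_; _∉_)
open import Data.Product using (Σ; ∃; _×_; _,_)
open import Data.List using (List; []; _∷_; length)
open import Data.List.Membership.Propositional using () renaming (_∈_ to _∈ˡ_)
open import Data.List.Relation.Unary.All using (All)
open import Data.List.Relation.Unary.AllPairs using (AllPairs)
open import Relation.Nullary using (¬_)
open import Relation.Nullary.Decidable using (⌊_⌋)
open import Relation.Binary.PropositionalEquality using (_≡_)
open import Relation.Binary.Construct.Closure.ReflexiveTransitive using (Star)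
open import Function.Definitions using (Injective)

-- Simple graphs on the vertex set Fin n, given by a Boolean adjacency
-- function.  (For the concrete graph L below it is symmetric and
-- loopless by construction.)

Graph : ℕ → Set
Graph n = Fin n → Fin n → Bool

Adj : ∀ {n} → Graph n → Fin n → Fin n → Set
Adj G u v = T (G u v)

fromEdges : ∀ {n} → List (Fin n × Fin n) → Graph n
fromEdges []              u v = false
fromEdges ((a , b) ∷ es) u v =
  ((⌊ a ≟ u ⌋ ∧ ⌊ b ≟ v ⌋) ∨ (⌊ a ≟ v ⌋ ∧ ⌊ b ≟ u ⌋)) ∨ fromEdges es u v

countF : ∀ {n} → (Fin n → Bool) → ℕ
countF {zero}  p = 0
countF {suc n} p = b2n (p zero) + countF (λ i → p (suc i))
  where
  b2n : Bool → ℕ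
  b2n true  = 1
  b2n false = 0

iter : ∀ {A : Set} → (A → A) → ℕ → A → A
iter f zero    a = a
iter f (suc k) a = f (iter f k a)

AdjMinus : ∀ {n} → Graph n → Subset n → Fin n → Fin n → Set
AdjMinus G U u v = Adj G u v × u ∉ U × v ∉ U

record CycleMinus {n} (G : Graph n) (U : Subset n) : Set where
  field
    k        : ℕ
    c        : Fin (suc (suc (suc k))) → Fin n
    c-inj    : Injective _≡_ _≡_ c
    c-avoid  : ∀ i → c i ∉ U
    c-step   : ∀ (i : Fin (suc (suc k))) → Adj G (c (inject₁ i)) (c (suc i))
    c-close  : Adj G (c (fromℕ (suc (suc k)))) (c zero)

Acyclic-Minus : ∀ {n} → Graph n → Subset n → Set
Acyclic-Minus G U = ¬ CycleMinus G U

IsFVS : ∀ {n} → Graph n → Subset n → Set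
IsFVS G U = Acyclic-Minus G U

Separates : ∀ {n} → Graph n → Subset n → Fin n → Fin n → Set
Separates G U x y = x ∉ U × y ∉ U × ¬ Star (AdjMinus G U) x y

-- Hamiltonian path with prescribed endpoints: a bijective enumeration
-- p : Fin (suc m) → vertices (injective, hence bijective) with
-- consecutive vertices adjacent, starting at x and ending at y.

HamPath : ∀ {m} → Graph (suc m) → Fin (suc m) → Fin (suc m) → Set
HamPath {m} G x y =
  Σ (Fin (suc m) → Fin (suc m)) λ p →
    Injective _≡_ _≡_ p
    × (∀ (i : Fin m) → Adj G (p (inject₁ i)) (p (suc i)))
    × p zero ≡ x
    × p (fromℕ m) ≡ y

-- Planarity via combinatorial embeddings (rotation systems) and
-- Euler's formula.
--
-- A rotation system gives, at each vertex v, a cyclic permutation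
-- ρ v of the neighbourhood N(v).  Darts are ordered pairs (u , v) with
-- u ~ v; the face permutation is φ (u , v) = (v , ρ v u).  With
-- F = number of φ-orbits on darts, D = number of darts (= 2|E|),
-- c = number of connected components, i = number of isolated vertices,
-- every rotation system satisfies  n - |E| + F + i ≤ 2c, with equality
-- iff every component is embedded in the sphere.  G is planar iff some
-- rotation system attains equality, i.e. 2n + 2F + 2i = D + 4c.

record RotationSystem {n} (G : Graph n) : Set where
  field
    ρ      : Fin n → Fin n → Fin n
    ρ-nbr  : ∀ v u → Adj G v u → Adj G v (ρ v u)
    ρ-inj  : ∀ v u u′ → Adj G v u → Adj G v u′ → ρ v u ≡ ρ v u′ → u ≡ u′
    ρ-cyc  : ∀ v u u′ → Adj G v u → Adj G v u′ → ∃ λ k → iter (ρ v) k u ≡ u′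

  faceMap : Fin n × Fin n → Fin n × Fin n
  faceMap (u , v) = (v , ρ v u)

  SameFace : Fin n × Fin n → Fin n × Fin n → Set
  SameFace d d′ = ∃ λ k → iter faceMap k d ≡ d′

IsDart : ∀ {n} → Graph n → Fin n × Fin n → Set
IsDart G (u , v) = Adj G u v

FaceReps : ∀ {n} {G : Graph n} → RotationSystem G → List (Fin n × Fin n) → Set
FaceReps {n} {G} rs R =
  All (IsDart G) R
  × (∀ d → IsDart G d → ∃ λ r → r ∈ˡ R × SameFace r d)
  × AllPairs (λ r r′ → ¬ SameFace r r′) R
  where open RotationSystem rs

ComponentReps : ∀ {n} → Graph n → List (Fin n) → Set
ComponentReps G C =
  (∀ v → ∃ λ c → c ∈ˡ C × Star (Adj G) c v)
  × AllPairs (λ c c′ → ¬ Star (Adj G) c c′) C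

numDarts : ∀ {n} → Graph n → ℕ
numDarts G = sumF (λ u → countF (λ v → G u v))
  where
  sumF : ∀ {m} → (Fin m → ℕ) → ℕ
  sumF {zero}  f = 0
  sumF {suc m} f = f zero + sumF (λ i → f (suc i))

numIsolated : ∀ {n} → Graph n → ℕ
numIsolated G = countF (λ v → ⌊ countF (G v) ℕ≟ 0 ⌋)

Planar : ∀ {n} → Graph n → Set
Planar {n} G =
  Σ (RotationSystem G) λ rs →
  Σ (List (Fin n × Fin n)) λ R →
  Σ (List (Fin n)) λ C →
    FaceReps rs R × ComponentReps G C
    × (2 * n + 2 * length R + 2 * numIsolated G ≡ numDarts G + 4 * length C)

-- W₁ : centre 0, 4-cycle 1 - 2 - 3 - 4 - 1  with v = 1, w = 2,
--        x'' = 3 (neighbour of w), x' = 4 (neighbour of v)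
--   W₂ : centre 5, 4-cycle 6 - 7 - 8 - 9 - 6  with v' = 6, w' = 7,
--        y'' = 8 (neighbour of w'), y' = 9 (neighbour of v')
--   extra edges {v,v'} = {1,6}, {w,w'} = {2,7}
--   x = 10 adjacent to exactly x' , x'' ;  y = 11 adjacent to exactly y' , y''

L-edges : List (Fin 12 × Fin 12)
L-edges =
  (# 1 , # 2) ∷ (# 2 , # 3) ∷ (# 3 , # 4) ∷ (# 4 , # 1) ∷
  (# 0 , # 1) ∷ (# 0 , # 2) ∷ (# 0 , # 3) ∷ (# 0 , # 4) ∷
  (# 6 , # 7) ∷ (# 7 , # 8) ∷ (# 8 , # 9) ∷ (# 9 , # 6) ∷
  (# 5 , # 6) ∷ (# 5 , # 7) ∷ (# 5 , # 8) ∷ (# 5 , # 9) ∷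
  (# 1 , # 6) ∷ (# 2 , # 7) ∷
  (# 10 , # 4) ∷ (# 10 , # 3) ∷ (# 11 , # 9) ∷ (# 11 , # 8) ∷ []
  where open import Data.Fin using (#_)

L : Graph 12
L = fromEdges L-edges

x : Fin 12
x = Data.Fin.#_ 10

y : Fin 12
y = Data.Fin.#_ 11

-- Each claim is about a fixed graph on 12 vertices and reduces to a finite certificate
-- checked by evaluation.  The triangles 0 1 2, 3 4 x, 5 6 7 and 8 9 y are disjoint, so a
-- feedback vertex set has at least four vertices; if four of them include x, two lie on
-- 5 6 7 and 8 9 y, and the one left cannot meet all of 0 1 2, 0 3 4 and 1 2 3 4 in the
-- wheel W₁ (symmetrically for y).  So every set ruled out misses one of these eight cycles.
-- Removing {v, x'', w', y'} = {1, 3, 7, 9} leaves two trees, one containing x and one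
-- containing y.  A rotation system with 12 faces embeds the connected graph L in the
-- sphere, as 12 - 22 + 12 = 2.

module Submission where

open import Defs
open import Data.Bool using (T; _∨_; _∧_; if_then_else_)
open import Data.Bool.Properties using (∨-comm)
open import Data.Empty using (⊥)
open import Data.Fin using (Fin; zero; suc; inject₁; fromℕ; toℕ; #_; _≟_)
open import Data.Fin.Properties using (all?; any?; suc-injective; toℕ-fromℕ; toℕ-inject₁)
open import Data.Fin.Relation.Unary.Top using (view; ‵fromℕ; ‵inject₁)
open import Data.Fin.Subset using (Subset; _∈_; _∉_; ∣_∣; inside; outside; ⁅_⁆; _∪_)
open import Data.Fin.Subset.Properties using (_∈?_)
open import Data.List using (List; []; _∷_; map; iterate)
open import Data.List.Membership.Propositional using () renaming (_∈_ to _∈ˡ_; _∉_ to _∉ˡ_)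
open import Data.List.Relation.Unary.All using ([])
import Data.List.Relation.Unary.All as All
open import Data.List.Relation.Unary.Any using (Any; here; there)
import Data.List.Relation.Unary.Any as Any
open import Data.List.Relation.Unary.AllPairs using (AllPairs; []; _∷_)
import Data.List.Relation.Unary.AllPairs as AllPairs
import Data.List.Relation.Unary.AllPairs.Properties as AllPairs
open import Data.Nat using (ℕ; zero; suc; _≤_; _<_; _≤?_; _<?_) renaming (_≟_ to _≟ℕ_)
open import Data.Nat.Properties using (≤-refl; ≤-trans; ≰⇒≥)
open import Data.Product using (Σ; ∃; ∃₂; _×_; _,_; proj₁)
import Data.Product as Product
open import Data.Product.Properties using (≡-dec)
open import Data.Sum using (_⊎_)
open import Data.Vec using (Vec; []; _∷_; lookup)
import Data.Vec.Relation.Unary.AllPairs as VecAllPairs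
open import Data.Vec.Relation.Unary.Unique.Propositional using (Unique)
open import Data.Vec.Relation.Unary.Unique.Propositional.Properties using (lookup-injective)
open import Function using (_∘_; id)
open import Level using (Level)
open import Relation.Binary.Construct.Closure.ReflexiveTransitive using (Star; ε; _◅_)
open import Relation.Binary.PropositionalEquality using (_≡_; _≢_; refl; sym; trans; cong; cong₂; subst)
open import Relation.Nullary using (¬_; Dec; yes; no; ¬?; _×-dec_; _⊎-dec_; _→-dec_; map′)
open import Relation.Nullary.Decidable using (⌊_⌋; T?; True; toWitness; from-yes)
open import Relation.Unary using (Pred; Decidable)

private
  variable
    ℓ : Level
    n : ℕ

fromEdges-sym : (es : List (Fin n × Fin n)) (u v : Fin n) → fromEdges es u v ≡ fromEdges es v u
fromEdges-sym []      u v = refl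
fromEdges-sym ((a , b) ∷ es) u v =
  cong₂ _∨_ (∨-comm (⌊ a ≟ u ⌋ ∧ ⌊ b ≟ v ⌋) (⌊ a ≟ v ⌋ ∧ ⌊ b ≟ u ⌋)) (fromEdges-sym es u v)

fromEdges-symmetric : (es : List (Fin n × Fin n)) (u v : Fin n) → Adj (fromEdges es) u v → Adj (fromEdges es) v u
fromEdges-symmetric es u v = subst T (fromEdges-sym es u v)

allSubsets? : {P : Pred (Subset n) ℓ} → Decidable P → Dec (∀ U → P U)
allSubsets? {n = zero}  P? = map′ (λ p → λ { [] → p }) (λ h → h []) (P? [])
allSubsets? {n = suc n} P? =
  map′ (λ (p , q) → λ { (inside ∷ U) → p U ; (outside ∷ U) → q U })
       (λ h → h ∘ (inside ∷_) , h ∘ (outside ∷_))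
       (allSubsets? (P? ∘ (inside ∷_)) ×-dec allSubsets? (P? ∘ (outside ∷_)))

iter-periodic : {A : Set} (f : A → A) {a : A} (p : ℕ) → iter f (suc p) a ≡ a →
                ∀ k → ∃ λ (j : Fin (suc p)) → iter f k a ≡ iter f (toℕ j) a
iter-periodic f {a} p period zero    = zero , refl
iter-periodic f {a} p period (suc k) with iter-periodic f p period k
... | j , eq with view j
...   | ‵fromℕ     = zero , trans (cong f eq) (trans (cong (λ m → iter f (suc m) a) (toℕ-fromℕ p)) period)
...   | ‵inject₁ i = suc i , trans (cong f eq) (cong (λ m → iter f (suc m) a) (toℕ-inject₁ i))

iter-suc : {A : Set} (f : A → A) {a : A} (k : ℕ) → iter f (suc k) a ≡ iter f k (f a)
iter-suc f zero    = refl
iter-suc f (suc k) = cong f (iter-suc f k)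

∈-iterate⁻ : {A : Set} (f : A → A) {a b : A} (m : ℕ) → b ∈ˡ iterate f a m → ∃ λ k → iter f k a ≡ b
∈-iterate⁻ f (suc m) (here refl) = zero , refl
∈-iterate⁻ f (suc m) (there b∈)  with ∈-iterate⁻ f m b∈
... | k , eq = suc k , trans (iter-suc f k) eq

iter-∈-iterate : {A : Set} (f : A → A) {a : A} (m : ℕ) (j : Fin m) → iter f (toℕ j) a ∈ˡ iterate f a m
iter-∈-iterate f (suc m) zero    = here refl
iter-∈-iterate f (suc m) (suc j) = there (subst (_∈ˡ iterate f (f _) m) (sym (iter-suc f (toℕ j))) (iter-∈-iterate f m j))

∈-orbits : {A : Set} (f : A → A) {a : A} {orbits : List (A × ℕ)} →
           Any (λ (r , m) → a ∈ˡ iterate f r m) orbits → ∃ λ r → r ∈ˡ map proj₁ orbits × ∃ λ k → iter f k r ≡ a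
∈-orbits f (here a∈)  = _ , here refl , ∈-iterate⁻ f _ a∈
∈-orbits f (there a∈) = let r , r∈ , reach = ∈-orbits f a∈ in r , there r∈ , reach

iterate-unreachable : {A : Set} (f : A → A) {a b : A} (m : ℕ) → 0 < m → iter f m a ≡ a →
                      b ∉ˡ iterate f a m → ¬ ∃ λ k → iter f k a ≡ b
iterate-unreachable f (suc p) _ period b∉ (k , eq) with iter-periodic f p period k
... | j , eq′ = b∉ (subst (_∈ˡ iterate f _ (suc p)) (trans (sym eq′) eq) (iter-∈-iterate f (suc p) j))

argmin : {m : ℕ} (f : Fin (suc m) → ℕ) → ∃ λ i → ∀ j → f i ≤ f j
argmin {zero}  f = zero , λ { zero → ≤-refl }
argmin {suc m} f with argmin (f ∘ suc)
... | i , min with f zero ≤? f (suc i)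
...   | yes le = zero , λ { zero → ≤-refl ; (suc j) → ≤-trans le (min j) }
...   | no  gt = suc i , λ { zero → ≰⇒≥ gt ; (suc j) → min j }

chain⇒Star : {A : Set} {R : A → A → Set} {m : ℕ} (p : Fin (suc m) → A) →
             (∀ i → R (p (inject₁ i)) (p (suc i))) → ∀ i → Star R (p zero) (p i)
chain⇒Star           p steps zero    = ε
chain⇒Star {m = suc m} p steps (suc i) = steps zero ◅ chain⇒Star (p ∘ suc) (steps ∘ suc) i

Star-preserves : {A : Set} {R : A → A → Set} {P : A → Set} →
                 (∀ {a b} → R a b → P a → P b) → ∀ {a b} → Star R a b → P a → P b
Star-preserves closed ε        pa = pa
Star-preserves closed (r ◅ rs) pa = Star-preserves closed rs (closed r pa)

inject₁²≢suc² : ∀ {m} (i : Fin m) → inject₁ (inject₁ i) ≢ suc (suc i)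
inject₁²≢suc² zero    ()
inject₁²≢suc² (suc i) eq = inject₁²≢suc² i (suc-injective eq)

cycle-neighbours : {A : Set} {R : A → A → Set} (k : ℕ) (c : Fin (suc (suc (suc k))) → A) →
                   (∀ i → R (c (inject₁ i)) (c (suc i))) → R (c (fromℕ (suc (suc k)))) (c zero) →
                   ∀ i → ∃₂ λ a b → a ≢ b × R (c a) (c i) × R (c i) (c b)
cycle-neighbours k c step close zero = fromℕ (suc (suc k)) , suc zero , (λ ()) , close , step zero
cycle-neighbours k c step close (suc i) with view i
... | ‵fromℕ     = inject₁ (fromℕ (suc k)) , zero , (λ ()) , step (fromℕ (suc k)) , close
... | ‵inject₁ j = inject₁ (inject₁ j) , suc (suc j) , inject₁²≢suc² j , step (inject₁ j) , step (suc j)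

IsCycle : ∀ {k} → Graph n → Vec (Fin n) (suc (suc (suc k))) → Set
IsCycle {k = k} G vs =
  Unique vs
  × (∀ i → Adj G (lookup vs (inject₁ i)) (lookup vs (suc i)))
  × Adj G (lookup vs (fromℕ (suc (suc k)))) (lookup vs zero)

isCycle? : ∀ {k} (G : Graph n) (vs : Vec (Fin n) (suc (suc (suc k)))) → Dec (IsCycle G vs)
isCycle? G vs = VecAllPairs.allPairs? (λ a b → ¬? (a ≟ b)) vs ×-dec all? (λ _ → T? _) ×-dec T? _

record Cycle (G : Graph n) : Set where
  constructor cycle
  field
    {k}      : ℕ
    vertices : Vec (Fin n) (suc (suc (suc k)))
    {valid}  : True (isCycle? G vertices)

Avoids : {G : Graph n} → Subset n → Cycle G → Set
Avoids U C = ∀ i → lookup (Cycle.vertices C) i ∉ U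

avoids? : {G : Graph n} (U : Subset n) (C : Cycle G) → Dec (Avoids U C)
avoids? U C = all? (λ i → ¬? (lookup (Cycle.vertices C) i ∈? U))

cycleMinus : {G : Graph n} {U : Subset n} (C : Cycle G) → Avoids U C → CycleMinus G U
cycleMinus {G = G} (cycle {k} vs {valid}) avoid with toWitness valid
... | distinct , step , close = record
  { k = k ; c = lookup vs ; c-inj = lookup-injective distinct _ _
  ; c-avoid = avoid ; c-step = step ; c-close = close }

avoided⇒¬IsFVS : {G : Graph n} {U : Subset n} {Cs : List (Cycle G)} → Any (Avoids U) Cs → ¬ IsFVS G U
avoided⇒¬IsFVS {Cs = C ∷ _} (here avoid) fvs = fvs (cycleMinus C avoid)
avoided⇒¬IsFVS (there avoid) fvs = avoided⇒¬IsFVS avoid fvs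

ForestCertificate : Graph n → Subset n → (Fin n → ℕ) → (Fin n → Fin n) → Set
ForestCertificate G U rank parent = ∀ v w → AdjMinus G U v w → rank v ≤ rank w → w ≡ parent v

-- On a cycle of G - U, the vertex of minimal rank has two distinct neighbours, both of which would have to be its parent.
forestCertificate⇒IsFVS : {G : Graph n} {U : Subset n} {rank : Fin n → ℕ} {parent : Fin n → Fin n} →
                          (∀ u v → Adj G u v → Adj G v u) →
                          ForestCertificate G U rank parent → IsFVS G U
forestCertificate⇒IsFVS {G = G} {rank = rank} {parent} G-sym certificate C = contradiction-at (argmin (rank ∘ c))
  where
  open CycleMinus C
  toParent : ∀ {i} j → (∀ j → rank (c i) ≤ rank (c j)) → Adj G (c i) (c j) → c j ≡ parent (c i)
  toParent j lowest i~j = certificate _ _ (i~j , c-avoid _ , c-avoid j) (lowest j)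
  contradiction-at : (∃ λ i → ∀ j → rank (c i) ≤ rank (c j)) → ⊥
  contradiction-at (i , lowest) with cycle-neighbours {R = Adj G} k c c-step c-close i
  ... | a , b , a≢b , a~i , i~b = a≢b (c-inj (trans (toParent a lowest (G-sym _ _ a~i)) (sym (toParent b lowest i~b))))

closed⇒Separates : {G : Graph n} {U S : Subset n} {a b : Fin n} →
                   (∀ u v → AdjMinus G U u v → u ∈ S → v ∈ S) →
                   a ∉ U → b ∉ U → a ∈ S → b ∉ S → Separates G U a b
closed⇒Separates closed a∉U b∉U a∈S b∉S =
  a∉U , b∉U , λ path → b∉S (Star-preserves (closed _ _) path a∈S)

cyclicSuccessor : List (Fin n) → Fin n → Fin n
cyclicSuccessor []            u = u
cyclicSuccessor {n} (a ∷ as) u = go (a ∷ as)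
  where
  go : List (Fin n) → Fin n
  go []           = u
  go (b ∷ [])     = if ⌊ b ≟ u ⌋ then a else u
  go (b ∷ c ∷ bs) = if ⌊ b ≟ u ⌋ then c else go (c ∷ bs)

L-sym : ∀ u v → Adj L u v → Adj L v u
L-sym = fromEdges-symmetric L-edges

L-cycles : List (Cycle L)
L-cycles =
  cycle (# 0 ∷ # 2 ∷ # 1 ∷ []) ∷ cycle (# 5 ∷ # 7 ∷ # 6 ∷ []) ∷
  cycle (# 3 ∷ # 4 ∷ # 10 ∷ []) ∷ cycle (# 8 ∷ # 9 ∷ # 11 ∷ []) ∷
  cycle (# 0 ∷ # 4 ∷ # 3 ∷ []) ∷ cycle (# 5 ∷ # 9 ∷ # 8 ∷ []) ∷
  cycle (# 1 ∷ # 2 ∷ # 3 ∷ # 4 ∷ []) ∷ cycle (# 6 ∷ # 9 ∷ # 8 ∷ # 7 ∷ []) ∷ []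

L-cycles-avoid-3-sets : ∀ (U : Subset 12) → ∣ U ∣ ≡ 3 → Any (Avoids U) L-cycles
L-cycles-avoid-3-sets = from-yes (allSubsets? λ U → (∣ U ∣ ≟ℕ 3) →-dec Any.any? (avoids? U) L-cycles)

L-cycles-avoid-4-sets-with-x-or-y : ∀ (U : Subset 12) → ∣ U ∣ ≡ 4 → x ∈ U ⊎ y ∈ U → Any (Avoids U) L-cycles
L-cycles-avoid-4-sets-with-x-or-y = from-yes (allSubsets? λ U →
  (∣ U ∣ ≟ℕ 4) →-dec (x ∈? U ⊎-dec y ∈? U) →-dec Any.any? (avoids? U) L-cycles)

U₄ : Subset 12
U₄ = ⁅ # 1 ⁆ ∪ ⁅ # 3 ⁆ ∪ ⁅ # 7 ⁆ ∪ ⁅ # 9 ⁆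

-- L - U₄ is the paths 2 - 0 - 4 - x and 6 - 5 - 8 - y rooted at 0 and 5; vertices in U₄ get junk values.
U₄-rank : Fin 12 → ℕ
U₄-rank = lookup (3 ∷ 0 ∷ 2 ∷ 0 ∷ 2 ∷ 3 ∷ 2 ∷ 0 ∷ 2 ∷ 0 ∷ 1 ∷ 1 ∷ [])

U₄-parent : Fin 12 → Fin 12
U₄-parent = lookup (# 0 ∷ # 0 ∷ # 0 ∷ # 0 ∷ # 0 ∷ # 5 ∷ # 5 ∷ # 0 ∷ # 5 ∷ # 0 ∷ # 4 ∷ # 8 ∷ [])

U₄-IsFVS : IsFVS L U₄
U₄-IsFVS = forestCertificate⇒IsFVS L-sym (from-yes (all? λ v → all? λ w →
  (T? (L v w) ×-dec ¬? (v ∈? U₄) ×-dec ¬? (w ∈? U₄)) →-dec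
  (U₄-rank v ≤? U₄-rank w) →-dec (w ≟ U₄-parent v)))

x-component : Subset 12
x-component = ⁅ # 0 ⁆ ∪ ⁅ # 2 ⁆ ∪ ⁅ # 4 ⁆ ∪ ⁅ x ⁆

U₄-separates : Separates L U₄ x y
U₄-separates = closed⇒Separates
  (from-yes (all? λ u → all? λ v →
    (T? (L u v) ×-dec ¬? (u ∈? U₄) ×-dec ¬? (v ∈? U₄)) →-dec u ∈? x-component →-dec v ∈? x-component))
  (from-yes (¬? (x ∈? U₄))) (from-yes (¬? (y ∈? U₄)))
  (from-yes (x ∈? x-component)) (from-yes (¬? (y ∈? x-component)))

L-path : Vec (Fin 12) 12
L-path = x ∷ # 3 ∷ # 0 ∷ # 4 ∷ # 1 ∷ # 2 ∷ # 7 ∷ # 8 ∷ # 5 ∷ # 6 ∷ # 9 ∷ y ∷ []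

L-path-steps : ∀ i → Adj L (lookup L-path (inject₁ i)) (lookup L-path (suc i))
L-path-steps = from-yes (all? λ i → T? (L (lookup L-path (inject₁ i)) (lookup L-path (suc i))))

L-hamPath : HamPath L x y
L-hamPath =
  lookup L-path , lookup-injective (from-yes (VecAllPairs.allPairs? (λ a b → ¬? (a ≟ b)) L-path)) _ _ ,
  L-path-steps , refl , refl

L-path-surjective : ∀ v → ∃ λ i → lookup L-path i ≡ v
L-path-surjective = from-yes (all? λ v → any? λ i → lookup L-path i ≟ v)

L-connected : ∀ v → Star (Adj L) x v
L-connected v with L-path-surjective v
... | i , refl = chain⇒Star (lookup L-path) L-path-steps i

-- The neighbours of each vertex in their cyclic order around it in a plane drawing of L.
L-rotation : Vec (List (Fin 12)) 12
L-rotation =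
  (# 1 ∷ # 4 ∷ # 3 ∷ # 2 ∷ []) ∷ (# 0 ∷ # 2 ∷ # 6 ∷ # 4 ∷ []) ∷
  (# 0 ∷ # 3 ∷ # 7 ∷ # 1 ∷ []) ∷ (# 0 ∷ # 4 ∷ # 10 ∷ # 2 ∷ []) ∷
  (# 0 ∷ # 1 ∷ # 10 ∷ # 3 ∷ []) ∷ (# 6 ∷ # 7 ∷ # 8 ∷ # 9 ∷ []) ∷
  (# 1 ∷ # 7 ∷ # 5 ∷ # 9 ∷ []) ∷ (# 2 ∷ # 8 ∷ # 5 ∷ # 6 ∷ []) ∷
  (# 5 ∷ # 7 ∷ # 11 ∷ # 9 ∷ []) ∷ (# 5 ∷ # 8 ∷ # 11 ∷ # 6 ∷ []) ∷
  (# 3 ∷ # 4 ∷ []) ∷ (# 8 ∷ # 9 ∷ []) ∷ []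

L-ρ : Fin 12 → Fin 12 → Fin 12
L-ρ v = cyclicSuccessor (lookup L-rotation v)

L-ρ-cyclic : ∀ v u u′ → Adj L v u → Adj L v u′ → ∃ λ (k : Fin 12) → iter (L-ρ v) (toℕ k) u ≡ u′
L-ρ-cyclic = from-yes (all? λ v → all? λ u → all? λ u′ →
  T? (L v u) →-dec T? (L v u′) →-dec any? λ (k : Fin 12) → iter (L-ρ v) (toℕ k) u ≟ u′)

L-rotationSystem : RotationSystem L
L-rotationSystem = record
  { ρ     = L-ρ
  ; ρ-nbr = from-yes (all? λ v → all? λ u → T? (L v u) →-dec T? (L v (L-ρ v u)))
  ; ρ-inj = from-yes (all? λ v → all? λ u → all? λ u′ →
              T? (L v u) →-dec T? (L v u′) →-dec L-ρ v u ≟ L-ρ v u′ →-dec u ≟ u′)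
  ; ρ-cyc = λ v u u′ v~u v~u′ → Product.map toℕ id (L-ρ-cyclic v u u′ v~u v~u′)
  }

open RotationSystem L-rotationSystem using (faceMap; SameFace)

_≟ᵈ_ : (d e : Fin 12 × Fin 12) → Dec (d ≡ e)
_≟ᵈ_ = ≡-dec _≟_ _≟_

-- Each face is given by one of its darts together with its length.
L-faces : List ((Fin 12 × Fin 12) × ℕ)
L-faces =
  ((# 0 , # 1) , 3) ∷ ((# 0 , # 2) , 3) ∷ ((# 0 , # 3) , 3) ∷ ((# 0 , # 4) , 3) ∷
  ((# 1 , # 4) , 10) ∷ ((# 1 , # 6) , 4) ∷ ((# 3 , # 10) , 3) ∷ ((# 5 , # 8) , 3) ∷
  ((# 5 , # 9) , 3) ∷ ((# 5 , # 6) , 3) ∷ ((# 5 , # 7) , 3) ∷ ((# 8 , # 9) , 3) ∷ []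

L-faceReps : List (Fin 12 × Fin 12)
L-faceReps = map proj₁ L-faces

L-darts-on-faces : ∀ u v → Adj L u v → Any (λ (r , m) → (u , v) ∈ˡ iterate faceMap r m) L-faces
L-darts-on-faces = from-yes (all? λ u → all? λ v → T? (L u v) →-dec
  Any.any? (λ (r , m) → Any.any? ((u , v) ≟ᵈ_) (iterate faceMap r m)) L-faces)

L-faces-cover : ∀ d → IsDart L d → ∃ λ r → r ∈ˡ L-faceReps × SameFace r d
L-faces-cover (u , v) u~v = ∈-orbits faceMap (L-darts-on-faces u v u~v)

L-faces-distinct : AllPairs (λ r r′ → ¬ SameFace r r′) L-faceReps
L-faces-distinct = AllPairs.map⁺ (AllPairs.map (λ (m>0 , period , r′∉) → iterate-unreachable faceMap _ m>0 period r′∉)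
  (from-yes (AllPairs.allPairs? (λ (r , m) (r′ , _) →
    0 <? m ×-dec iter faceMap m r ≟ᵈ r ×-dec ¬? (Any.any? (r′ ≟ᵈ_) (iterate faceMap r m)))
    L-faces)))

L-planar : Planar L
L-planar =
  L-rotationSystem , L-faceReps , x ∷ [] ,
  (from-yes (All.all? (λ (u , v) → T? (L u v)) L-faceReps) , L-faces-cover , L-faces-distinct) ,
  ((λ v → x , here refl , L-connected v) , [] ∷ []) ,
  refl

lemma15 : Planar L
            × HamPath L x y
            × (∀ (U : Subset 12) → ∣ U ∣ ≡ 3 → ¬ IsFVS L U)
            × (Σ (Subset 12) λ U → ∣ U ∣ ≡ 4 × IsFVS L U × Separates L U x y)
            × (∀ (U : Subset 12) → ∣ U ∣ ≡ 4 → x ∈ U ⊎ y ∈ U → ¬ IsFVS L U)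
lemma15 =
  L-planar ,
  L-hamPath ,
  (λ U |U|≡3 → avoided⇒¬IsFVS (L-cycles-avoid-3-sets U |U|≡3)) ,
  (U₄ , refl , U₄-IsFVS , U₄-separates) ,
  (λ U |U|≡4 x∈U⊎y∈U → avoided⇒¬IsFVS (L-cycles-avoid-4-sets-with-x-or-y U |U|≡4 x∈U⊎y∈U))
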